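{- Let $p\ge1$ and let $\phi_n$ ($n\ge1$) be the number of $BCI(p)$-terms of size $n(2p+1)-1$. Then for $n\ge 3$, $$2\phi_1\phi_{n-1}\le\sum_{l=1}^{n-1}\phi_l\phi_{n-l}\le 2\phi_1\phi_{n-1}+(n-3)\phi_2\phi_{n-2}.$$
   Context: Lambda-terms are generated by the grammar $T::=x\mid (T*T)\mid \lambda x.T$; an abstraction $\lambda x.T$ binds the free occurrences of $x$ in $T$; a term is closed if no variable occurrence is free. Terms are counted up to renaming of bound variables. Equivalently a closed lambda-term is a rooted plane unary-binary tree (applications = binary nodes, abstractions = unary nodes, variable occurrences = leaves) with, for each leaf, a pointer from exactly one unary ancestor. Size: $|x|=1$, $|\lambda x.T|=1+|T|$, $|(S*T)|=1+|S|+|T|$. $BCI(p)$ is the set of (non-empty) closed lambda-terms in which every abstraction binds exactly $p$ variable occurrences. -}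

module Defs where

open import Data.Nat using (ℕ; zero; suc; _+_; _*_; _∸_)
open import Data.Fin using (Fin; zero; suc)
open import Data.Product using (Σ; _×_)
open import Data.Unit using (⊤)
open import Data.List using (List; applyUpTo)
open import Data.Nat.ListAction using (sum)
open import Relation.Binary.PropositionalEquality using (_≡_)
open import Relation.Nullary using (Dec; yes; no)
open import Data.Fin using (_≟_)

-- Lambda terms in de Bruijn notation (terms up to renaming of bound
-- variables); Term n = terms whose free variables are among n bound ones.
-- Closed terms are Term 0.
data Term : ℕ → Set where
  var : ∀ {n} → Fin n → Term n
  app : ∀ {n} → Term n → Term n → Term n
  lam : ∀ {n} → Term (suc n) → Term n

size : ∀ {n} → Term n → ℕ
size (var _)   = 1
size (app s t) = suc (size s + size t)
size (lam t)   = suc (size t)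

occ : ∀ {n} → Fin n → Term n → ℕ
occ i (var j) with i ≟ j
... | yes _ = 1
... | no  _ = 0
occ i (app s t) = occ i s + occ i t
occ i (lam t)   = occ (suc i) t

EveryLamBinds : ℕ → ∀ {n} → Term n → Set
EveryLamBinds p (var _)   = ⊤
EveryLamBinds p (app s t) = EveryLamBinds p s × EveryLamBinds p t
EveryLamBinds p (lam t)   = occ zero t ≡ p × EveryLamBinds p t

BCITerm : ℕ → ℕ → Set
BCITerm p m = Σ (Term 0) (λ t → size t ≡ m × EveryLamBinds p t)

conv : (ℕ → ℕ) → ℕ → ℕ
conv φ n = sum (applyUpTo (λ i → φ (suc i) * φ (n ∸ suc i)) (n ∸ 1))

-- Removing the root abstraction of a BCI(p)-term with n + 2 abstractions and pruning its
-- p bound leaves one by one, each with its parent application, leaves a closed term with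
-- n + 1 abstractions. Conversely the leaves can be grafted back in
-- A n = ∏_{k<p} 2 (m + 2k) ways, m = (n + 1)(2p + 1) - 1, and every term arises in p! orders;
-- terms with an application at the root split into two smaller ones. Hence
--   p! φ (n + 2) = A n · φ (n + 1) + p! Σ_l φ l φ (n + 2 - l).
-- As A grows fast enough, strong induction on this recurrence gives the log-convexity
-- φ a φ b ≤ φ (a - 1) φ (b + 1) for 3 ≤ a ≤ b, so each of the n - 3 middle terms of the
-- convolution is at most φ 2 φ (n - 2), while the two outer ones are φ 1 φ (n - 1).

module Submission where

open import Defs
open import Data.Bool using (Bool; true; false)
open import Data.Empty using (⊥-elim)
open import Data.Fin using (Fin; zero; suc; toℕ; fromℕ<; punchIn; punchOut; _≟_)
open import Data.Fin.Permutation using (↔⇒≡)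
import Data.Fin.Properties as Finₚ
open import Data.List using (applyUpTo; _∷ʳ_; [_])
open import Data.List.Properties using (applyUpTo-∷ʳ)
open import Data.Maybe using (Maybe; just; nothing)
open import Data.Nat using (ℕ; zero; suc; _+_; _*_; _∸_; _≤_; _<_; s≤s; z≤n; >-nonZero)
open import Data.Nat.Induction using (<-rec)
open import Data.Nat.ListAction using (sum)
open import Data.Nat.ListAction.Properties using (sum-++)
open import Data.Nat.Properties hiding (_≟_)
open import Data.Nat.Solver using (module +-*-Solver)
open import Algebra.Properties.CommutativeMonoid.Sum +-0-commutativeMonoid
  using (sum-syntax; ∑-distrib-+; sum-cong-≗; sum-replicate-zero)
open import Data.Product using (Σ; _×_; _,_; proj₁; proj₂)
open import Data.Product.Function.Dependent.Propositional using (Σ-↔)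
open import Data.Product.Function.NonDependent.Propositional using (_×-↔_)
open import Data.Sum using (_⊎_; inj₁; inj₂)
open import Data.Sum.Function.Propositional using (_⊎-↔_)
open import Data.Unit using (tt)
open import Data.Vec.Functional using (replicate)
open import Function.Bundles using (_↔_; mk↔ₛ′; Inverse)
open import Function.Properties.Inverse using (↔-refl; ↔-sym; ↔-trans)
open import Function.Related.Propositional using (module EquationalReasoning; bijection)
open import Function.Related.TypeIsomorphisms using (×-comm; Σ-assoc; ×-distribʳ-⊎)
open import Relation.Binary.PropositionalEquality
  using (_≡_; _≢_; refl; sym; trans; cong; cong₂; subst; subst₂; module ≡-Reasoning)
open import Relation.Nullary using (yes; no; Irrelevant)

open Inverse using (to; from; strictlyInverseˡ; strictlyInverseʳ)

infixr 5 _⟫_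
_⟫_ : ∀ {a b c} {A : Set a} {B : Set b} {C : Set c} → A ↔ B → B ↔ C → A ↔ C
_⟫_ = ↔-trans

Σ-≡-irrelevant : {A : Set} {P : A → Set} → (∀ x → Irrelevant (P x)) →
                 {x y : A} {px : P x} {py : P y} → x ≡ y → _≡_ {A = Σ A P} (x , px) (y , py)
Σ-≡-irrelevant irr {x} {px = px} {py} refl = cong (x ,_) (irr x px py)

Fin-cong : ∀ {m n} → m ≡ n → Fin m ↔ Fin n
Fin-cong refl = ↔-refl

Σ-Fin0↔ : {F : Fin 0 → Set} → Σ (Fin 0) F ↔ Fin 0
Σ-Fin0↔ = mk↔ₛ′ (λ { (() , _) }) (λ ()) (λ ()) (λ { (() , _) })

Σ-Fin↔sum : ∀ k (f : ℕ → ℕ) → Σ (Fin k) (λ i → Fin (f (toℕ i))) ↔ Fin (sum (applyUpTo f k))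
Σ-Fin↔sum zero f = Σ-Fin0↔
Σ-Fin↔sum (suc k) f = peel ⟫ (↔-refl ⊎-↔ Σ-Fin↔sum k (λ i → f (suc i))) ⟫ ↔-sym Finₚ.+↔⊎
  where
  peel : Σ (Fin (suc k)) (λ i → Fin (f (toℕ i))) ↔ (Fin (f 0) ⊎ Σ (Fin k) (λ i → Fin (f (suc (toℕ i)))))
  peel = mk↔ₛ′ (λ { (zero , x) → inj₁ x ; (suc i , x) → inj₂ (i , x) })
               (λ { (inj₁ x) → zero , x ; (inj₂ (i , x)) → suc i , x })
               (λ { (inj₁ _) → refl ; (inj₂ _) → refl })
               (λ { (zero , _) → refl ; (suc _ , _) → refl })

module _ {A B : Set} (P : A → Set) (Q : B → Set)
         (P-irr : ∀ a → Irrelevant (P a)) (Q-irr : ∀ b → Irrelevant (Q b))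
         (f : (a : A) → P a → Maybe B) (g : B → A)
         (g-P : ∀ b → Q b → P (g b))
         (f-Q : ∀ a pa b → f a pa ≡ just b → Q b)
         (f-defined : ∀ a pa → f a pa ≢ nothing)
         (f∘g : ∀ b qb → f (g b) (g-P b qb) ≡ just b)
         (g∘f : ∀ a pa b → f a pa ≡ just b → g b ≡ a) where

  private
    defined : (m : Maybe B) → m ≢ nothing → Σ B (λ b → m ≡ just b)
    defined (just b) _  = b , refl
    defined nothing  ne = ⊥-elim (ne refl)

    just-injective : ∀ {x y : B} → _≡_ {A = Maybe B} (just x) (just y) → x ≡ y
    just-injective refl = refl

  Σ-↔-partialInverse : Σ A P ↔ Σ B Q
  Σ-↔-partialInverse = mk↔ₛ′ forth back forth∘back back∘forth
    where
    value : (a : A) (pa : P a) → Σ B (λ b → f a pa ≡ just b)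
    value a pa = defined (f a pa) (f-defined a pa)
    forth : Σ A P → Σ B Q
    forth (a , pa) = proj₁ (value a pa) , f-Q a pa _ (proj₂ (value a pa))
    back : Σ B Q → Σ A P
    back (b , qb) = g b , g-P b qb
    forth∘back : ∀ y → forth (back y) ≡ y
    forth∘back (b , qb) = Σ-≡-irrelevant Q-irr
      (just-injective (trans (sym (proj₂ (value (g b) (g-P b qb)))) (f∘g b qb)))
    back∘forth : ∀ x → back (forth x) ≡ x
    back∘forth (a , pa) = Σ-≡-irrelevant P-irr (g∘f a pa _ (proj₂ (value a pa)))

occ-self : ∀ {n} (i : Fin n) → occ i (var i) ≡ 1
occ-self i with i ≟ i
... | yes _ = refl
... | no i≢i = ⊥-elim (i≢i refl)

occ-other : ∀ {n} {i j : Fin n} → i ≢ j → occ i (var j) ≡ 0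
occ-other {i = i} {j} i≢j with i ≟ j
... | yes i≡j = ⊥-elim (i≢j i≡j)
... | no _ = refl

-- A site where a new leaf can be grafted: as a new left or right sibling of a subterm.
data Site : ∀ {n} → Term n → Set where
  here  : ∀ {n} {t : Term n} → Bool → Site t
  left  : ∀ {n} {s u : Term n} → Site s → Site (app s u)
  right : ∀ {n} {s u : Term n} → Site u → Site (app s u)
  under : ∀ {n} {t : Term (suc n)} → Site t → Site (lam t)

graft : ∀ {n} (i : Fin n) (t : Term n) → Site t → Term n
graft i t         (here false) = app (var i) t
graft i t         (here true)  = app t (var i)
graft i (app s u) (left q)     = app (graft i s q) u
graft i (app s u) (right q)    = app s (graft i u q)
graft i (lam t)   (under q)    = lam (graft (suc i) t q)

Occurrence : ∀ {n} → Fin n → Term n → Set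
Occurrence i (var j)   = i ≡ j
Occurrence i (app s u) = Occurrence i s ⊎ Occurrence i u
Occurrence i (lam t)   = Occurrence (suc i) t

grafted : ∀ {n} (i : Fin n) (t : Term n) (q : Site t) → Occurrence i (graft i t q)
grafted i t         (here false) = inj₁ refl
grafted i t         (here true)  = inj₂ refl
grafted i (app s u) (left q)     = inj₁ (grafted i s q)
grafted i (app s u) (right q)    = inj₂ (grafted i u q)
grafted i (lam t)   (under q)    = grafted (suc i) t q

-- Removes an occurrence together with its parent application node; undefined
-- (nothing) when the occurrence is the whole term or the body of an abstraction.
prune : ∀ {n} (i : Fin n) (t : Term n) → Occurrence i t → Maybe (Σ (Term n) Site)
prune i (var j) o = nothing
prune i (app s u) (inj₁ o) with prune i s o
... | nothing       = just (u , here false)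
... | just (s′ , q) = just (app s′ u , left q)
prune i (app s u) (inj₂ o) with prune i u o
... | nothing       = just (s , here true)
... | just (u′ , q) = just (app s u′ , right q)
prune i (lam t) o with prune (suc i) t o
... | nothing       = nothing
... | just (t′ , q) = just (lam t′ , under q)

prune-graft : ∀ {n} (i : Fin n) (t : Term n) (q : Site t) →
              prune i (graft i t q) (grafted i t q) ≡ just (t , q)
prune-graft i t         (here false) = refl
prune-graft i t         (here true)  = refl
prune-graft i (app s u) (left q)  rewrite prune-graft i s q = refl
prune-graft i (app s u) (right q) rewrite prune-graft i u q = refl
prune-graft i (lam t)   (under q) rewrite prune-graft (suc i) t q = refl

occ-graft : ∀ {n} (i : Fin n) (t : Term n) (q : Site t) → occ i (graft i t q) ≡ suc (occ i t)
occ-graft i t         (here false) rewrite occ-self i = refl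
occ-graft i t         (here true)  rewrite occ-self i = +-comm (occ i t) 1
occ-graft i (app s u) (left q)     rewrite occ-graft i s q = refl
occ-graft i (app s u) (right q)    rewrite occ-graft i u q = +-suc (occ i s) (occ i u)
occ-graft i (lam t)   (under q)    = occ-graft (suc i) t q

occ-graft-other : ∀ {n} {j i : Fin n} → j ≢ i → (t : Term n) (q : Site t) →
                  occ j (graft i t q) ≡ occ j t
occ-graft-other j≢i t         (here false) rewrite occ-other j≢i = refl
occ-graft-other {j = j} j≢i t (here true)  rewrite occ-other j≢i = +-identityʳ (occ j t)
occ-graft-other j≢i (app s u) (left q)     rewrite occ-graft-other j≢i s q = refl
occ-graft-other j≢i (app s u) (right q)    rewrite occ-graft-other j≢i u q = refl
occ-graft-other j≢i (lam t)   (under q)    =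
  occ-graft-other (λ sj≡si → j≢i (Finₚ.suc-injective sj≡si)) t q

size-graft : ∀ {n} (i : Fin n) (t : Term n) (q : Site t) → size (graft i t q) ≡ 2 + size t
size-graft i t         (here false) = refl
size-graft i t         (here true)  = cong suc (+-comm (size t) 1)
size-graft i (app s u) (left q)     rewrite size-graft i s q = refl
size-graft i (app s u) (right q)    rewrite size-graft i u q =
  cong suc (trans (+-suc (size s) (suc (size u))) (cong suc (+-suc (size s) (size u))))
size-graft i (lam t)   (under q)    rewrite size-graft (suc i) t q = refl

Site↔ : ∀ {n} (t : Term n) → Site t ↔ Fin (2 * size t)
Site↔ (var j) = mk↔ₛ′ (λ { (here b) → to bool b }) (λ x → here (from bool x))
  (strictlyInverseˡ bool) (λ { (here b) → cong here (strictlyInverseʳ bool b) })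
  where
  bool : Bool ↔ Fin 2
  bool = ↔-sym Finₚ.2↔Bool
Site↔ (app s u) = sites ⟫ (↔-sym Finₚ.2↔Bool ⊎-↔ (Site↔ s ⊎-↔ Site↔ u) ⟫ ↔-sym Finₚ.+↔⊎)
                ⟫ ↔-sym Finₚ.+↔⊎ ⟫ Fin-cong (sym count)
  where
  sites : Site (app s u) ↔ (Bool ⊎ (Site s ⊎ Site u))
  sites = mk↔ₛ′ (λ { (here b) → inj₁ b ; (left q) → inj₂ (inj₁ q) ; (right q) → inj₂ (inj₂ q) })
                (λ { (inj₁ b) → here b ; (inj₂ (inj₁ q)) → left q ; (inj₂ (inj₂ q)) → right q })
                (λ { (inj₁ b) → refl ; (inj₂ (inj₁ q)) → refl ; (inj₂ (inj₂ q)) → refl })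
                (λ { (here b) → refl ; (left q) → refl ; (right q) → refl })
  count : 2 * size (app s u) ≡ 2 + (2 * size s + 2 * size u)
  count = trans (*-suc 2 (size s + size u)) (cong (2 +_) (*-distribˡ-+ 2 (size s) (size u)))
Site↔ (lam t) = sites ⟫ (↔-sym Finₚ.2↔Bool ⊎-↔ Site↔ t) ⟫ ↔-sym Finₚ.+↔⊎ ⟫ Fin-cong (sym (*-suc 2 (size t)))
  where
  sites : Site (lam t) ↔ (Bool ⊎ Site t)
  sites = mk↔ₛ′ (λ { (here b) → inj₁ b ; (under q) → inj₂ q })
                (λ { (inj₁ b) → here b ; (inj₂ q) → under q })
                (λ { (inj₁ b) → refl ; (inj₂ q) → refl })
                (λ { (here b) → refl ; (under q) → refl })

Occurrence↔ : ∀ {n} (i : Fin n) (t : Term n) → Occurrence i t ↔ Fin (occ i t)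
Occurrence↔ i (var j) with i ≟ j
... | yes refl = mk↔ₛ′ (λ _ → zero) (λ _ → refl) (λ { zero → refl }) (λ { refl → refl })
... | no i≢j   = mk↔ₛ′ (λ i≡j → ⊥-elim (i≢j i≡j)) (λ ()) (λ ()) (λ i≡j → ⊥-elim (i≢j i≡j))
Occurrence↔ i (app s u) = (Occurrence↔ i s ⊎-↔ Occurrence↔ i u) ⟫ ↔-sym Finₚ.+↔⊎
Occurrence↔ i (lam t)   = Occurrence↔ (suc i) t

weaken : ∀ {n} (i : Fin (suc n)) → Term n → Term (suc n)
weaken i (var j)   = var (punchIn i j)
weaken i (app s u) = app (weaken i s) (weaken i u)
weaken i (lam t)   = lam (weaken (suc i) t)

occ-weaken : ∀ {n} (i : Fin (suc n)) (j : Fin n) (t : Term n) → occ (punchIn i j) (weaken i t) ≡ occ j t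
occ-weaken i j (var k) with j ≟ k
... | yes refl = occ-self (punchIn i j)
... | no j≢k   = occ-other (λ eq → j≢k (Finₚ.punchIn-injective i j k eq))
occ-weaken i j (app s u) = cong₂ _+_ (occ-weaken i j s) (occ-weaken i j u)
occ-weaken i j (lam t)   = occ-weaken (suc i) (suc j) t

occ-weaken-self : ∀ {n} (i : Fin (suc n)) (t : Term n) → occ i (weaken i t) ≡ 0
occ-weaken-self i (var k)   = occ-other (λ eq → Finₚ.punchInᵢ≢i i k (sym eq))
occ-weaken-self i (app s u) = cong₂ _+_ (occ-weaken-self i s) (occ-weaken-self i u)
occ-weaken-self i (lam t)   = occ-weaken-self (suc i) t

size-weaken : ∀ {n} (i : Fin (suc n)) (t : Term n) → size (weaken i t) ≡ size t
size-weaken i (var k)   = refl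
size-weaken i (app s u) = cong suc (cong₂ _+_ (size-weaken i s) (size-weaken i u))
size-weaken i (lam t)   = cong suc (size-weaken (suc i) t)

strengthen : ∀ {n} (i : Fin (suc n)) (t : Term (suc n)) → occ i t ≡ 0 → Term n
strengthen i (var j) o = var (punchOut {i = i} {j = j} i≢j)
  where
  i≢j : i ≢ j
  i≢j refl = 1+n≢0 (trans (sym (occ-self i)) o)
strengthen i (app s u) o = app (strengthen i s (m+n≡0⇒m≡0 (occ i s) o)) (strengthen i u (m+n≡0⇒n≡0 (occ i s) o))
strengthen i (lam t)   o = lam (strengthen (suc i) t o)

weaken-strengthen : ∀ {n} (i : Fin (suc n)) (t : Term (suc n)) (o : occ i t ≡ 0) → weaken i (strengthen i t o) ≡ t
weaken-strengthen i (var j)   o = cong var (Finₚ.punchIn-punchOut _)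
weaken-strengthen i (app s u) o = cong₂ app (weaken-strengthen i s _) (weaken-strengthen i u _)
weaken-strengthen i (lam t)   o = cong lam (weaken-strengthen (suc i) t o)

strengthen-weaken : ∀ {n} (i : Fin (suc n)) (t : Term n) (o : occ i (weaken i t) ≡ 0) → strengthen i (weaken i t) o ≡ t
strengthen-weaken i (var j)   o = cong var (trans (Finₚ.punchOut-cong i refl) (Finₚ.punchOut-punchIn i))
strengthen-weaken i (app s u) o = cong₂ app (strengthen-weaken i s _) (strengthen-weaken i u _)
strengthen-weaken i (lam t)   o = cong lam (strengthen-weaken (suc i) t o)

Σ-reorder : {A : Set} {F G : A → Set} →
            Σ (Σ A F) (λ x → G (proj₁ x)) ↔ Σ (Σ A G) (λ x → F (proj₁ x))
Σ-reorder = mk↔ₛ′ (λ { ((t , a) , b) → (t , b) , a }) (λ { ((t , b) , a) → (t , a) , b })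
                  (λ _ → refl) (λ _ → refl)

rising : ℕ → ℕ → ℕ
rising x zero    = 1
rising x (suc k) = (x + k) * rising x k

rising-pos : ∀ x k → 1 ≤ rising (suc x) k
rising-pos x zero    = s≤s z≤n
rising-pos x (suc k) = *-mono-≤ (s≤s (z≤n {x + k})) (rising-pos x k)

rising-suc : ∀ x k → rising x (suc k) ≡ x * rising (suc x) k
rising-suc x zero    = cong (_* 1) (+-identityʳ x)
rising-suc x (suc k) = begin
  (x + suc k) * rising x (suc k)           ≡⟨ cong₂ _*_ (+-suc x k) (rising-suc x k) ⟩
  (suc x + k) * (x * rising (suc x) k)     ≡⟨ solve 3 (λ a x r → a :* (x :* r) := x :* (a :* r)) refl (suc x + k) x (rising (suc x) k) ⟩
  x * ((suc x + k) * rising (suc x) k)     ∎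
  where open ≡-Reasoning
        open +-*-Solver

-- The number of ways to graft k leaves, one after the other, onto a term of size m.
graftings : ℕ → ℕ → ℕ
graftings m zero    = 1
graftings m (suc k) = graftings m k * (2 * (m + 2 * k))

BCITerm-cong : ∀ {p m m′} → m ≡ m′ → BCITerm p m ↔ BCITerm p m′
BCITerm-cong refl = ↔-refl

module Binding (p : ℕ) where

  Binds : ∀ {n} → Term n → Set
  Binds = EveryLamBinds p

  binds-graft : ∀ {n} (i : Fin n) (t : Term n) (q : Site t) → Binds t → Binds (graft i t q)
  binds-graft i t         (here false) bt       = tt , bt
  binds-graft i t         (here true)  bt       = bt , tt
  binds-graft i (app s u) (left q)     (bs , bu) = binds-graft i s q bs , bu
  binds-graft i (app s u) (right q)    (bs , bu) = bs , binds-graft i u q bu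
  binds-graft i (lam t)   (under q)    (b0 , bt) =
    trans (occ-graft-other (λ ()) t q) b0 , binds-graft (suc i) t q bt

  binds-graft⁻ : ∀ {n} (i : Fin n) (t : Term n) (q : Site t) → Binds (graft i t q) → Binds t
  binds-graft⁻ i t         (here false) (_ , bt)  = bt
  binds-graft⁻ i t         (here true)  (bt , _)  = bt
  binds-graft⁻ i (app s u) (left q)     (bs , bu) = binds-graft⁻ i s q bs , bu
  binds-graft⁻ i (app s u) (right q)    (bs , bu) = bs , binds-graft⁻ i u q bu
  binds-graft⁻ i (lam t)   (under q)    (b0 , bt) =
    trans (sym (occ-graft-other (λ ()) t q)) b0 , binds-graft⁻ (suc i) t q bt

  binds-irrelevant : ∀ {n} (t : Term n) → Irrelevant (Binds t)
  binds-irrelevant (var _)   tt      tt        = refl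
  binds-irrelevant (app s u) (a , b) (a′ , b′) = cong₂ _,_ (binds-irrelevant s a a′) (binds-irrelevant u b b′)
  binds-irrelevant (lam t)   (a , b) (a′ , b′) = cong₂ _,_ (≡-irrelevant a a′) (binds-irrelevant t b b′)

  -- Pruning is undefined only on the lone leaf: a lone leaf under an abstraction would
  -- be an abstraction binding nothing.
  prune-lone : 1 ≤ p → ∀ {n} (i : Fin n) (t : Term n) (o : Occurrence i t) → Binds t →
               prune i t o ≡ nothing → _≡_ {A = Σ (Term n) (Occurrence i)} (var i , refl) (t , o)
  prune-lone _ i (var j) refl _ _ = refl
  prune-lone _ i (app s u) (inj₁ o) _ eq with prune i s o
  prune-lone _ i (app s u) (inj₁ o) _ () | nothing
  prune-lone _ i (app s u) (inj₁ o) _ () | just _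
  prune-lone _ i (app s u) (inj₂ o) _ eq with prune i u o
  prune-lone _ i (app s u) (inj₂ o) _ () | nothing
  prune-lone _ i (app s u) (inj₂ o) _ () | just _
  prune-lone 1≤p i (lam t) o (b0 , bt) eq with prune (suc i) t o in eq′
  ... | nothing with prune-lone 1≤p (suc i) t o bt eq′
  prune-lone 1≤p i (lam .(var (suc i))) .refl (b0 , bt) eq | nothing | refl = ⊥-elim (<⇒≢ 1≤p b0)
  prune-lone _ i (lam t) o (b0 , bt) () | just _

  graft-prune : 1 ≤ p → ∀ {n} (i : Fin n) (t : Term n) (o : Occurrence i t) → Binds t →
                ∀ {r} → prune i t o ≡ just r →
                _≡_ {A = Σ (Term n) (Occurrence i)} (graft i (proj₁ r) (proj₂ r) , grafted i (proj₁ r) (proj₂ r)) (t , o)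
  graft-prune _ i (var j) o _ ()
  graft-prune 1≤p i (app s u) (inj₁ o) (bs , bu) eq with prune i s o in eq′
  graft-prune 1≤p i (app s u) (inj₁ o) (bs , bu) refl | nothing =
    cong (λ { (x , y) → app x u , inj₁ y }) (prune-lone 1≤p i s o bs eq′)
  graft-prune 1≤p i (app s u) (inj₁ o) (bs , bu) refl | just _ =
    cong (λ { (x , y) → app x u , inj₁ y }) (graft-prune 1≤p i s o bs eq′)
  graft-prune 1≤p i (app s u) (inj₂ o) (bs , bu) eq with prune i u o in eq′
  graft-prune 1≤p i (app s u) (inj₂ o) (bs , bu) refl | nothing =
    cong (λ { (x , y) → app s x , inj₂ y }) (prune-lone 1≤p i u o bu eq′)
  graft-prune 1≤p i (app s u) (inj₂ o) (bs , bu) refl | just _ =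
    cong (λ { (x , y) → app s x , inj₂ y }) (graft-prune 1≤p i u o bu eq′)
  graft-prune 1≤p i (lam t) o (b0 , bt) eq with prune (suc i) t o in eq′
  graft-prune 1≤p i (lam t) o (b0 , bt) () | nothing
  graft-prune 1≤p i (lam t) o (b0 , bt) refl | just _ =
    cong (λ { (x , y) → lam x , y }) (graft-prune 1≤p (suc i) t o bt eq′)

  Counted : ∀ {n} → Fin n → ℕ → ℕ → Term n → Set
  Counted i k m t = occ i t ≡ k × size t ≡ m × Binds t

  counted-irrelevant : ∀ {n} (i : Fin n) k m (t : Term n) → Irrelevant (Counted i k m t)
  counted-irrelevant i k m t (a , b , c) (a′ , b′ , c′) =
    cong₂ _,_ (≡-irrelevant a a′) (cong₂ _,_ (≡-irrelevant b b′) (binds-irrelevant t c c′))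

  Terms : ∀ {n} → Fin n → ℕ → ℕ → Set
  Terms {n} i k m = Σ (Term n) (Counted i k m)

  Terms-cong : ∀ {n} (i : Fin n) {k k′ m m′} → k ≡ k′ → m ≡ m′ → Terms i k m ↔ Terms i k′ m′
  Terms-cong i refl refl = ↔-refl

  -- Marking one of the k+1 occurrences of i and pruning it is the same as choosing
  -- a site to graft a new occurrence of i.
  graft-↔ : 1 ≤ p → ∀ {n} (i : Fin n) k m →
            (Terms i (suc k) (2 + m) × Fin (suc k)) ↔ (Terms i k m × Fin (2 * m))
  graft-↔ 1≤p i k m =
      ↔-sym (Σ-↔ ↔-refl (λ {x} → Occurrence↔ i (proj₁ x) ⟫ Fin-cong (proj₁ (proj₂ x))))
    ⟫ Σ-reorder
    ⟫ Σ-↔-partialInverse Pruneable Graftable (λ a → counted-irrelevant i _ _ (proj₁ a))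
        (λ b → counted-irrelevant i _ _ (proj₁ b)) (λ a _ → prune i (proj₁ a) (proj₂ a))
        (λ b → graft i (proj₁ b) (proj₂ b) , grafted i (proj₁ b) (proj₂ b))
        counted-graft counted-prune defined (λ b _ → prune-graft i (proj₁ b) (proj₂ b))
        (λ { (t , o) (_ , _ , bt) r eq → graft-prune 1≤p i t o bt eq })
    ⟫ Σ-reorder
    ⟫ Σ-↔ ↔-refl (λ {x} → Site↔ (proj₁ x) ⟫ Fin-cong (cong (2 *_) (proj₁ (proj₂ (proj₂ x)))))
    where
    Pruneable : Σ (Term _) (Occurrence i) → Set
    Pruneable a = Counted i (suc k) (2 + m) (proj₁ a)
    Graftable : Σ (Term _) Site → Set
    Graftable b = Counted i k m (proj₁ b)
    counted-graft : ∀ b → Graftable b → Counted i (suc k) (2 + m) (graft i (proj₁ b) (proj₂ b))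
    counted-graft (t , q) (ot , st , bt) =
      trans (occ-graft i t q) (cong suc ot) , trans (size-graft i t q) (cong (2 +_) st) , binds-graft i t q bt
    counted-prune : ∀ a (pa : Pruneable a) r → prune i (proj₁ a) (proj₂ a) ≡ just r → Graftable r
    counted-prune (t , o) (ot , st , bt) (t′ , q) eq with graft-prune 1≤p i t o bt eq
    ... | refl = suc-injective (trans (sym (occ-graft i t′ q)) ot)
               , +-cancelˡ-≡ 2 _ _ (trans (sym (size-graft i t′ q)) st)
               , binds-graft⁻ i t′ q bt
    defined : ∀ a (pa : Pruneable a) → prune i (proj₁ a) (proj₂ a) ≢ nothing
    defined (t , o) (_ , st , bt) eq with prune-lone 1≤p i t o bt eq
    ... | refl = 1≢2+m st
      where
      1≢2+m : 1 ≢ 2 + m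
      1≢2+m ()

  graft-iterate-↔ : 1 ≤ p → ∀ {n} (i : Fin n) j m k →
    (Terms i (j + k) (m + 2 * k) × Fin (rising (suc j) k)) ↔ (Terms i j m × Fin (graftings m k))
  graft-iterate-↔ 1≤p i j m zero = Terms-cong i (+-identityʳ j) (+-identityʳ m) ×-↔ ↔-refl
  graft-iterate-↔ 1≤p i j m (suc k) =
      (Terms-cong i (+-suc j k) size-eq ×-↔ Finₚ.*↔×)
    ⟫ ×-assocˡ
    ⟫ (graft-↔ 1≤p i (j + k) (m + 2 * k) ×-↔ ↔-refl)
    ⟫ ↔-sym ×-assocˡ ⟫ (↔-refl ×-↔ ×-comm _ _) ⟫ ×-assocˡ
    ⟫ (graft-iterate-↔ 1≤p i j m k ×-↔ ↔-refl)
    ⟫ ↔-sym ×-assocˡ ⟫ (↔-refl ×-↔ ↔-sym Finₚ.*↔×)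
    where
    size-eq : m + 2 * suc k ≡ 2 + (m + 2 * k)
    size-eq = trans (cong (m +_) (*-suc 2 k)) (trans (+-suc m (suc (2 * k))) (cong suc (+-suc m (2 * k))))
    ×-assocˡ : ∀ {A B C : Set} → (A × (B × C)) ↔ ((A × B) × C)
    ×-assocˡ = ↔-sym Σ-assoc

  binds-weaken : ∀ {n} (i : Fin (suc n)) (t : Term n) → Binds t → Binds (weaken i t)
  binds-weaken i (var k)   _         = tt
  binds-weaken i (app s u) (bs , bu) = binds-weaken i s bs , binds-weaken i u bu
  binds-weaken i (lam t)   (b0 , bt) = trans (occ-weaken (suc i) zero t) b0 , binds-weaken (suc i) t bt

  binds-weaken⁻ : ∀ {n} (i : Fin (suc n)) (t : Term n) → Binds (weaken i t) → Binds t
  binds-weaken⁻ i (var k)   _         = tt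
  binds-weaken⁻ i (app s u) (bs , bu) = binds-weaken⁻ i s bs , binds-weaken⁻ i u bu
  binds-weaken⁻ i (lam t)   (b0 , bt) = trans (sym (occ-weaken (suc i) zero t)) b0 , binds-weaken⁻ (suc i) t bt

  closed-↔ : ∀ m → Terms (zero {0}) 0 m ↔ BCITerm p m
  closed-↔ m = mk↔ₛ′ forth back
    (λ { (s , _) → Σ-≡-irrelevant closed-irrelevant (strengthen-weaken zero s _) })
    (λ { (t , _) → Σ-≡-irrelevant (counted-irrelevant zero 0 m) (weaken-strengthen zero t _) })
    where
    closed-irrelevant : (t : Term 0) → Irrelevant (size t ≡ m × Binds t)
    closed-irrelevant t (a , b) (a′ , b′) = cong₂ _,_ (≡-irrelevant a a′) (binds-irrelevant t b b′)
    forth : Terms zero 0 m → BCITerm p m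
    forth (t , o , st , bt) = strengthen zero t o
      , trans (sym (size-weaken zero _)) (trans (cong size (weaken-strengthen zero t o)) st)
      , binds-weaken⁻ zero _ (subst Binds (sym (weaken-strengthen zero t o)) bt)
    back : BCITerm p m → Terms zero 0 m
    back (s , ss , bs) = weaken zero s , occ-weaken-self zero s , trans (size-weaken zero s) ss , binds-weaken zero s bs

  #lam : ∀ {n} → Term n → ℕ
  #lam (var _)   = 0
  #lam (app s u) = #lam s + #lam u
  #lam (lam t)   = suc (#lam t)

  free : ∀ {n} → Term n → ℕ
  free {n} t = ∑[ i < n ] occ i t

  free-var : ∀ {n} (j : Fin n) → free (var j) ≡ 1
  free-var {suc n} zero    = cong suc (trans (sum-cong-≗ {x = λ i → occ (suc i) (var zero)} {replicate n 0} (λ _ → refl))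
                                                 (sum-replicate-zero n))
  free-var {suc n} (suc j) = trans (sum-cong-≗ (λ i → occ-weaken zero i (var j))) (free-var j)

  -- D = 2p + 1, written so that suc k * D ∸ 1 reduces to 2p + k * D.
  D : ℕ
  D = suc (2 * p)

  -- size + 1 = #lam + 2 #leaves (a binary tree has one application fewer than leaves),
  -- and #leaves = p #lam + free.
  size-invariant : ∀ {n} (t : Term n) → Binds t → suc (size t) ≡ #lam t * D + 2 * free t
  size-invariant (var j) _ = sym (cong (2 *_) (free-var j))
  size-invariant (app s u) (bs , bu) = begin
    suc (suc (size s + size u))                  ≡⟨ cong suc (sym (+-suc (size s) (size u))) ⟩
    suc (size s) + suc (size u)                  ≡⟨ cong₂ _+_ (size-invariant s bs) (size-invariant u bu) ⟩
    (#lam s * D + 2 * free s) + (#lam u * D + 2 * free u)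
      ≡⟨ solve 5 (λ a b d x y → (a :* d :+ con 2 :* x) :+ (b :* d :+ con 2 :* y) := (a :+ b) :* d :+ con 2 :* (x :+ y))
               refl (#lam s) (#lam u) D (free s) (free u) ⟩
    (#lam s + #lam u) * D + 2 * (free s + free u) ≡⟨ cong (λ x → (#lam s + #lam u) * D + 2 * x) (sym (∑-distrib-+ (λ i → occ i s) (λ i → occ i u))) ⟩
    #lam (app s u) * D + 2 * free (app s u)      ∎
    where open ≡-Reasoning
          open +-*-Solver
  size-invariant {n} (lam t) (b0 , bt) = begin
    suc (suc (size t))                                      ≡⟨ cong suc (size-invariant t bt) ⟩
    suc (#lam t * D + 2 * (occ zero t + free (lam t)))      ≡⟨ cong (λ x → suc (#lam t * D + 2 * (x + free (lam t)))) b0 ⟩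
    suc (#lam t * D + 2 * (p + free (lam t)))
      ≡⟨ solve 3 (λ l q f → con 1 :+ (l :* (con 1 :+ con 2 :* q) :+ con 2 :* (q :+ f))
                            := (con 1 :+ l) :* (con 1 :+ con 2 :* q) :+ con 2 :* f) refl (#lam t) p (free (lam t)) ⟩
    suc (#lam t) * D + 2 * free (lam t)                     ∎
    where open ≡-Reasoning
          open +-*-Solver

  size-closed : (t : Term 0) → Binds t → suc (size t) ≡ #lam t * D
  size-closed t bt = trans (size-invariant t bt) (+-identityʳ (#lam t * D))

  Applications : ℕ → Set
  Applications M = Σ (Term 0 × Term 0) (λ x → size (proj₁ x) + size (proj₂ x) ≡ M × Binds (proj₁ x) × Binds (proj₂ x))

  BCITerm-suc-↔ : ∀ M → BCITerm p (suc M) ↔ (Terms (zero {0}) p M ⊎ Applications M)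
  BCITerm-suc-↔ M = mk↔ₛ′ forth back forth∘back back∘forth
    where
    forth : BCITerm p (suc M) → Terms zero p M ⊎ Applications M
    forth (app s u , st , bs , bu) = inj₂ ((s , u) , suc-injective st , bs , bu)
    forth (lam t , st , b0 , bt)   = inj₁ (t , b0 , suc-injective st , bt)
    back : Terms zero p M ⊎ Applications M → BCITerm p (suc M)
    back (inj₁ (t , b0 , st , bt))        = lam t , cong suc st , b0 , bt
    back (inj₂ ((s , u) , st , bs , bu)) = app s u , cong suc st , bs , bu
    forth∘back : ∀ y → forth (back y) ≡ y
    forth∘back (inj₁ (t , b0 , st , bt))        = cong (λ e → inj₁ (t , b0 , e , bt)) (≡-irrelevant _ _)
    forth∘back (inj₂ ((s , u) , st , bs , bu)) = cong (λ e → inj₂ ((s , u) , e , bs , bu)) (≡-irrelevant _ _)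
    back∘forth : ∀ x → back (forth x) ≡ x
    back∘forth (app s u , st , bs , bu) = cong (λ e → app s u , e , bs , bu) (≡-irrelevant _ _)
    back∘forth (lam t , st , b0 , bt)   = cong (λ e → lam t , e , b0 , bt) (≡-irrelevant _ _)

  -- φ k counts these: closed terms with k abstractions.
  Graded : ℕ → Set
  Graded k = BCITerm p (k * D ∸ 1)

  -- The ways to graft the p occurrences bound by a new root abstraction onto a term with
  -- 1 + n abstractions.
  A : ℕ → ℕ
  A n = graftings (suc n * D ∸ 1) p

  size-graded : (t : Term 0) → Binds t → ∀ {k} → #lam t ≡ k → size t ≡ k * D ∸ 1
  size-graded t bt refl = cong (_∸ 1) (size-closed t bt)

  #lam-graded : (t : Term 0) → Binds t → ∀ k → 1 ≤ k → size t ≡ k * D ∸ 1 → #lam t ≡ k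
  #lam-graded t bt (suc k) _ st = *-cancelʳ-≡ _ _ D (trans (sym (size-closed t bt)) (cong suc st))

  #lam-pos : (t : Term 0) → Binds t → 1 ≤ #lam t
  #lam-pos t bt with #lam t | size-closed t bt
  ... | suc _ | _ = s≤s z≤n

  split-index : ∀ {a b n} → a + b ≡ suc n → 1 ≤ a → 1 ≤ b →
                Σ (Fin n) (λ l → a ≡ suc (toℕ l) × b ≡ n ∸ toℕ l)
  split-index {suc a} {b} {n} a+b≡1+n _ 1≤b =
    fromℕ< a<n , cong suc (sym (Finₚ.toℕ-fromℕ< a<n)) , b≡n∸a
    where
    a+b≡n : a + b ≡ n
    a+b≡n = suc-injective a+b≡1+n
    a<n : a < n
    a<n = subst (a <_) a+b≡n (m<m+n a 1≤b)
    b≡n∸a : b ≡ n ∸ toℕ (fromℕ< a<n)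
    b≡n∸a = trans (sym (m+n∸m≡n a b)) (cong₂ _∸_ a+b≡n (sym (Finₚ.toℕ-fromℕ< a<n)))

  module _ {M n : ℕ} (M≡ : suc (suc M) ≡ suc n * D) (s u : Term 0) (bs : Binds s) (bu : Binds u) where

    #lam-app : size s + size u ≡ M → #lam s + #lam u ≡ suc n
    #lam-app ss+su = *-cancelʳ-≡ _ _ D (trans (sym (size-closed (app s u) (bs , bu)))
                                              (trans (cong (λ x → suc (suc x)) ss+su) M≡))

    size-app : #lam s + #lam u ≡ suc n → size s + size u ≡ M
    size-app ls+lu = suc-injective (suc-injective
      (trans (size-closed (app s u) (bs , bu)) (trans (cong (_* D) ls+lu) (sym M≡))))

  Applications-↔ : ∀ n M → suc (suc M) ≡ suc n * D →
                   Applications M ↔ Σ (Fin n) (λ l → Graded (suc (toℕ l)) × Graded (n ∸ toℕ l))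
  Applications-↔ n M M≡ = mk↔ₛ′ forth back forth∘back back∘forth
    where
    Split : Set
    Split = Σ (Fin n) (λ l → Graded (suc (toℕ l)) × Graded (n ∸ toℕ l))
    index : ∀ s u (bs : Binds s) (bu : Binds u) → size s + size u ≡ M →
            Σ (Fin n) (λ l → #lam s ≡ suc (toℕ l) × #lam u ≡ n ∸ toℕ l)
    index s u bs bu ss+su = split-index (#lam-app M≡ s u bs bu ss+su) (#lam-pos s bs) (#lam-pos u bu)
    forth : Applications M → Split
    forth ((s , u) , ss+su , bs , bu) =
      proj₁ i , (s , size-graded s bs (proj₁ (proj₂ i)) , bs) , (u , size-graded u bu (proj₂ (proj₂ i)) , bu)
      where
      i : Σ (Fin n) (λ l → #lam s ≡ suc (toℕ l) × #lam u ≡ n ∸ toℕ l)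
      i = index s u bs bu ss+su
    back : Split → Applications M
    back (l , (s , ss , bs) , (u , su , bu)) = (s , u) , size-app M≡ s u bs bu ls+lu , bs , bu
      where
      l<n : toℕ l < n
      l<n = Finₚ.toℕ<n l
      ls+lu : #lam s + #lam u ≡ suc n
      ls+lu = trans (cong₂ _+_ (#lam-graded s bs _ (s≤s z≤n) ss) (#lam-graded u bu _ (m<n⇒0<n∸m l<n) su))
                    (cong suc (m+[n∸m]≡n (<⇒≤ l<n)))
    same-index : ∀ {l l′ : Fin n} → l′ ≡ l → ∀ {s u ss ss′ su su′ bs bs′ bu bu′} →
      _≡_ {A = Split} (l′ , (s , ss′ , bs′) , (u , su′ , bu′)) (l , (s , ss , bs) , (u , su , bu))
    same-index refl {ss = ss} {ss′} {su} {su′} {bs} {bs′} {bu} {bu′}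
      rewrite ≡-irrelevant ss ss′ | ≡-irrelevant su su′
            | binds-irrelevant _ bs bs′ | binds-irrelevant _ bu bu′ = refl
    forth∘back : ∀ y → forth (back y) ≡ y
    forth∘back y@(l , (s , ss , bs) , (u , su , bu)) =
      same-index (Finₚ.toℕ-injective (suc-injective (trans (sym (proj₁ (proj₂ i))) (#lam-graded s bs _ (s≤s z≤n) ss))))
      where
      i : Σ (Fin n) (λ l → #lam s ≡ suc (toℕ l) × #lam u ≡ n ∸ toℕ l)
      i = index s u bs bu (proj₁ (proj₂ (back y)))
    back∘forth : ∀ x → back (forth x) ≡ x
    back∘forth ((s , u) , ss+su , bs , bu) = cong (λ e → (s , u) , e , bs , bu) (≡-irrelevant _ _)

  size-pos : ∀ {n} (t : Term n) → 1 ≤ size t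
  size-pos (var _)   = s≤s z≤n
  size-pos (app _ _) = s≤s z≤n
  size-pos (lam _)   = s≤s z≤n

  lone-↔ : Terms (zero {0}) 1 1 ↔ Fin 1
  lone-↔ = mk↔ₛ′ (λ _ → zero) (λ _ → var zero , refl , refl , tt) (λ { zero → refl }) lone
    where
    lone : ∀ x → (var zero , refl , refl , tt) ≡ x
    lone (var zero , refl , refl , tt) = refl
    lone (app s u , _ , ss , _) = ⊥-elim (<⇒≢ (+-mono-≤ (size-pos s) z≤n) (sym (suc-injective ss)))
    lone (lam t , _ , st , _)   = ⊥-elim (<⇒≢ (size-pos t) (sym (suc-injective st)))

graftings-mono : ∀ k {m m′} → m ≤ m′ → graftings m k ≤ graftings m′ k
graftings-mono zero    m≤m′ = ≤-refl
graftings-mono (suc k) m≤m′ = *-mono-≤ (graftings-mono k m≤m′) (*-monoʳ-≤ 2 (+-monoˡ-≤ (2 * k) m≤m′))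

graftings-suc : ∀ m k → graftings m (suc k) ≡ 2 * m * graftings (m + 2) k
graftings-suc m zero    = solve 1 (λ m → con 1 :* (con 2 :* (m :+ con 2 :* con 0)) := con 2 :* m :* con 1) refl m
  where open +-*-Solver
graftings-suc m (suc k) = trans (cong (_* (2 * (m + 2 * suc k))) (graftings-suc m k))
  (solve 3 (λ g m k → con 2 :* m :* g :* (con 2 :* (m :+ con 2 :* (con 1 :+ k)))
                      := con 2 :* m :* (g :* (con 2 :* ((m :+ con 2) :+ con 2 :* k)))) refl (graftings (m + 2) k) m k)
  where open +-*-Solver

module Growth (q : ℕ) where

  open Binding (suc q) using (D; A)

  -- Definitionally N x = suc x * D ∸ 1, so that A x = graftings (N x) (suc q).
  N : ℕ → ℕ
  N x = 2 * suc q + x * D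

  R : ℕ → ℕ
  R x = graftings (N x + 2) q

  B : ℕ
  B = graftings 1 q

  A≡ : ∀ x → A x ≡ 2 * N x * R x
  A≡ x = graftings-suc (N x) q

  N-mono : ∀ {x y} → x ≤ y → N x ≤ N y
  N-mono x≤y = +-monoʳ-≤ (2 * suc q) (*-monoˡ-≤ D x≤y)

  N-suc : ∀ y → N (suc y) ≡ N y + D
  N-suc y = solve 3 (λ a d yd → a :+ (d :+ yd) := (a :+ yd) :+ d) refl (2 * suc q) D (y * D)
    where open +-*-Solver

  A-mono : ∀ {x y} → x ≤ y → A x ≤ A y
  A-mono x≤y = graftings-mono (suc q) (N-mono x≤y)

  R-mono : ∀ {x y} → x ≤ y → R x ≤ R y
  R-mono x≤y = graftings-mono q (+-monoˡ-≤ 2 (N-mono x≤y))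

  B≤R : ∀ x → B ≤ R x
  B≤R x = graftings-mono q (≤-trans (s≤s z≤n) (m≤n+m 2 (N x)))

  A-step : ∀ y → A y + 2 * D * R y ≤ A (suc y)
  A-step y = begin
    A y + 2 * D * R y              ≡⟨ cong (_+ 2 * D * R y) (A≡ y) ⟩
    2 * N y * R y + 2 * D * R y    ≡⟨ solve 3 (λ n d r → con 2 :* n :* r :+ con 2 :* d :* r := con 2 :* (n :+ d) :* r) refl (N y) D (R y) ⟩
    2 * (N y + D) * R y            ≡⟨ cong (λ t → 2 * t * R y) (sym (N-suc y)) ⟩
    2 * N (suc y) * R y            ≤⟨ *-monoʳ-≤ (2 * N (suc y)) (R-mono (n≤1+n y)) ⟩
    2 * N (suc y) * R (suc y)      ≡⟨ sym (A≡ (suc y)) ⟩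
    A (suc y)                      ∎
    where open ≤-Reasoning
          open +-*-Solver

  linear-bound : ∀ x → suc x * (2 * N 0 + 1) ≤ 4 * D * N (suc x)
  linear-bound x = begin
    suc x * (2 * N 0 + 1)  ≤⟨ *-mono-≤ x≤N small-constant ⟩
    N (suc x) * (4 * D)    ≡⟨ *-comm (N (suc x)) (4 * D) ⟩
    4 * D * N (suc x)      ∎
    where
    open ≤-Reasoning
    x≤N : suc x ≤ N (suc x)
    x≤N = ≤-trans (m≤m*n (suc x) D) (m≤n+m (suc x * D) (2 * suc q))
    small-constant : 2 * N 0 + 1 ≤ 4 * D
    small-constant = subst₂ _≤_
      (solve 1 (λ q → con 5 :+ con 4 :* q := con 2 :* (con 2 :* (con 1 :+ q) :+ con 0) :+ con 1) refl q)
      (solve 1 (λ q → con 12 :+ con 8 :* q := con 4 :* (con 1 :+ con 2 :* (con 1 :+ q))) refl q)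
      (+-mono-≤ (m≤m+n 5 7) (*-monoˡ-≤ q (m≤n+m 4 4)))
      where open +-*-Solver

  -- The increments of A grow fast enough to absorb the middle terms of the convolution.
  A-gap : ∀ x → A (2 + x) * A (1 + x) + suc x * (A 0 * B + B * B) ≤ A (3 + x) * A (1 + x)
  A-gap x = begin
    A₂ * A₁ + suc x * (A 0 * B + B * B)
      ≡⟨ cong (λ t → A₂ * A₁ + suc x * (t * B + B * B)) (A≡ 0) ⟩
    A₂ * A₁ + suc x * (2 * N 0 * R 0 * B + B * B)
      ≤⟨ +-monoʳ-≤ (A₂ * A₁) (*-monoʳ-≤ (suc x) (+-monoʳ-≤ (2 * N 0 * R 0 * B) (*-monoˡ-≤ B (B≤R 0)))) ⟩
    A₂ * A₁ + suc x * (2 * N 0 * R 0 * B + R 0 * B)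
      ≡⟨ cong (A₂ * A₁ +_) (solve 4 (λ k n r b → k :* (con 2 :* n :* r :* b :+ r :* b) := k :* (con 2 :* n :+ con 1) :* (r :* b))
                                    refl (suc x) (N 0) (R 0) B) ⟩
    A₂ * A₁ + suc x * (2 * N 0 + 1) * (R 0 * B)
      ≤⟨ +-monoʳ-≤ (A₂ * A₁) (*-mono-≤ (linear-bound x) (*-mono-≤ (R-mono (z≤n {suc x})) (B≤R (2 + x)))) ⟩
    A₂ * A₁ + 4 * D * N (suc x) * (R (suc x) * R (2 + x))
      ≡⟨ cong (A₂ * A₁ +_) (solve 4 (λ d n r₁ r₂ → con 4 :* d :* n :* (r₁ :* r₂) := con 2 :* d :* r₂ :* (con 2 :* n :* r₁))
                                    refl D (N (suc x)) (R (suc x)) (R (2 + x))) ⟩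
    A₂ * A₁ + 2 * D * R (2 + x) * (2 * N (suc x) * R (suc x))
      ≡⟨ cong (λ t → A₂ * A₁ + 2 * D * R (2 + x) * t) (sym (A≡ (suc x))) ⟩
    A₂ * A₁ + 2 * D * R (2 + x) * A₁
      ≡⟨ sym (*-distribʳ-+ A₁ A₂ (2 * D * R (2 + x))) ⟩
    (A₂ + 2 * D * R (2 + x)) * A₁
      ≤⟨ *-monoˡ-≤ A₁ (A-step (2 + x)) ⟩
    A (3 + x) * A₁ ∎
    where
    open ≤-Reasoning
    open +-*-Solver
    A₁ : ℕ
    A₁ = A (1 + x)
    A₂ : ℕ
    A₂ = A (2 + x)

module Recurrence (q : ℕ) (φ : ℕ → ℕ)
  (φ↔ : ∀ n → 1 ≤ n → Fin (φ n) ↔ BCITerm (suc q) (n * (2 * suc q + 1) ∸ 1)) where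

  open Binding (suc q)

  -- = p!, the number of orders in which the p bound occurrences can be pruned.
  orders : ℕ
  orders = rising 1 (suc q)

  φ↔Graded : ∀ n → 1 ≤ n → Fin (φ n) ↔ Graded n
  φ↔Graded n 1≤n = φ↔ n 1≤n ⟫ BCITerm-cong (cong (λ d → n * d ∸ 1) (+-comm (2 * suc q) 1))

  counting₁ : Fin (φ 1 * rising 2 q) ↔ Fin (1 * graftings 1 q + 0 * rising 2 q)
  counting₁ = begin
    Fin (φ 1 * rising 2 q)                        ↔⟨ Finₚ.*↔× ⟩
    (Fin (φ 1) × P)                               ↔⟨ (φ↔Graded 1 (s≤s z≤n) ⟫ BCITerm-cong size≡ ⟫ BCITerm-suc-↔ M) ×-↔ ↔-refl ⟩
    ((Terms zero (1 + q) M ⊎ Applications M) × P) ↔⟨ ×-distribʳ-⊎ ⟩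
    ((Terms zero (1 + q) M × P) ⊎ (Applications M × P))
      ↔⟨ graft-iterate-↔ (s≤s z≤n) zero 1 1 q ⊎-↔ (Applications-↔ 0 M (sym (cong suc size≡)) ⟫ Σ-Fin0↔) ×-↔ ↔-refl ⟩
    ((Terms zero 1 1 × Fin (graftings 1 q)) ⊎ (Fin 0 × P))
      ↔⟨ ((lone-↔ ×-↔ ↔-refl) ⟫ ↔-sym Finₚ.*↔×) ⊎-↔ ↔-sym Finₚ.*↔× ⟩
    (Fin (1 * graftings 1 q) ⊎ Fin (0 * rising 2 q)) ↔⟨ ↔-sym Finₚ.+↔⊎ ⟩
    Fin (1 * graftings 1 q + 0 * rising 2 q)      ∎
    where
    open EquationalReasoning {k = bijection}
    M : ℕ
    M = 1 + 2 * q
    size≡ : 1 * D ∸ 1 ≡ suc M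
    size≡ = trans (+-identityʳ (2 * suc q)) (*-suc 2 q)
    P : Set
    P = Fin (rising 2 q)

  recurrence₁ : orders * φ 1 ≡ graftings 1 q
  recurrence₁ = begin
    orders * φ 1               ≡⟨ cong (_* φ 1) (trans (rising-suc 1 q) (*-identityˡ _)) ⟩
    rising 2 q * φ 1           ≡⟨ *-comm (rising 2 q) (φ 1) ⟩
    φ 1 * rising 2 q           ≡⟨ ↔⇒≡ counting₁ ⟩
    1 * graftings 1 q + 0      ≡⟨ trans (+-identityʳ _) (*-identityˡ _) ⟩
    graftings 1 q              ∎
    where open ≡-Reasoning

  counting : ∀ n → Fin (φ (2 + n) * orders) ↔ Fin (φ (suc n) * A n + conv φ (2 + n) * orders)
  counting n = begin
    Fin (φ (2 + n) * orders)                        ↔⟨ Finₚ.*↔× ⟩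
    (Fin (φ (2 + n)) × P)                           ↔⟨ (φ↔Graded (2 + n) (s≤s z≤n) ⟫ BCITerm-cong size≡ ⟫ BCITerm-suc-↔ M) ×-↔ ↔-refl ⟩
    ((Terms zero (suc q) M ⊎ Applications M) × P)   ↔⟨ ×-distribʳ-⊎ ⟩
    ((Terms zero (suc q) M × P) ⊎ (Applications M × P))
      ↔⟨ graft-iterate-↔ (s≤s z≤n) zero 0 m (suc q) ⊎-↔ applications ×-↔ ↔-refl ⟩
    ((Terms zero 0 m × Fin (A n)) ⊎ (Fin (conv φ (2 + n)) × P))
      ↔⟨ (((closed-↔ m ⟫ ↔-sym (φ↔Graded (suc n) (s≤s z≤n))) ×-↔ ↔-refl) ⟫ ↔-sym Finₚ.*↔×) ⊎-↔ ↔-sym Finₚ.*↔× ⟩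
    (Fin (φ (suc n) * A n) ⊎ Fin (conv φ (2 + n) * orders)) ↔⟨ ↔-sym Finₚ.+↔⊎ ⟩
    Fin (φ (suc n) * A n + conv φ (2 + n) * orders) ∎
    where
    open EquationalReasoning {k = bijection}
    m : ℕ
    m = suc n * D ∸ 1
    M : ℕ
    M = m + 2 * suc q
    size≡ : (2 + n) * D ∸ 1 ≡ suc M
    size≡ = solve 2 (λ a b → a :+ (con 1 :+ (a :+ b)) := con 1 :+ ((a :+ b) :+ a)) refl (2 * suc q) (n * D)
      where open +-*-Solver
    P : Set
    P = Fin orders
    applications : Applications M ↔ Fin (conv φ (2 + n))
    applications = Applications-↔ (suc n) M (cong suc (sym size≡))
      ⟫ Σ-↔ ↔-refl (λ {l} → ↔-sym (φ↔Graded (suc (toℕ l)) (s≤s z≤n) ×-↔ φ↔Graded (suc n ∸ toℕ l) (m<n⇒0<n∸m (Finₚ.toℕ<n l)))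
                          ⟫ ↔-sym Finₚ.*↔×)
      ⟫ Σ-Fin↔sum (suc n) (λ i → φ (suc i) * φ (2 + n ∸ suc i))

  recurrence : ∀ n → orders * φ (2 + n) ≡ φ (suc n) * A n + orders * conv φ (2 + n)
  recurrence n = begin
    orders * φ (2 + n)                            ≡⟨ *-comm orders (φ (2 + n)) ⟩
    φ (2 + n) * orders                            ≡⟨ ↔⇒≡ (counting n) ⟩
    φ (suc n) * A n + conv φ (2 + n) * orders     ≡⟨ cong (φ (suc n) * A n +_) (*-comm (conv φ (2 + n)) orders) ⟩
    φ (suc n) * A n + orders * conv φ (2 + n)     ∎
    where open ≡-Reasoning

  orders²φ₂ : orders * (orders * φ 2) ≡ A 0 * graftings 1 q + graftings 1 q * graftings 1 q
  orders²φ₂ = begin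
    orders * (orders * φ 2)                               ≡⟨ cong (orders *_) (recurrence 0) ⟩
    orders * (φ 1 * A 0 + orders * (φ 1 * φ 1 + 0))
      ≡⟨ solve 3 (λ c f a → c :* (f :* a :+ c :* (f :* f :+ con 0)) := a :* (c :* f) :+ (c :* f) :* (c :* f))
               refl orders (φ 1) (A 0) ⟩
    A 0 * (orders * φ 1) + (orders * φ 1) * (orders * φ 1) ≡⟨ cong (λ b → A 0 * b + b * b) recurrence₁ ⟩
    A 0 * graftings 1 q + graftings 1 q * graftings 1 q   ∎
    where open ≡-Reasoning
          open +-*-Solver

sum-applyUpTo-last : ∀ (g : ℕ → ℕ) m → sum (applyUpTo g (suc m)) ≡ sum (applyUpTo g m) + g m
sum-applyUpTo-last g m = begin
  sum (applyUpTo g (suc m))              ≡⟨ cong sum (sym (applyUpTo-∷ʳ g m)) ⟩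
  sum (applyUpTo g m ∷ʳ g m)             ≡⟨ sum-++ (applyUpTo g m) [ g m ] ⟩
  sum (applyUpTo g m) + (g m + 0)        ≡⟨ cong (sum (applyUpTo g m) +_) (+-identityʳ (g m)) ⟩
  sum (applyUpTo g m) + g m              ∎
  where open ≡-Reasoning

sum-applyUpTo-≤ : ∀ (g : ℕ → ℕ) m K → (∀ i → i < m → g i ≤ K) → sum (applyUpTo g m) ≤ m * K
sum-applyUpTo-≤ g zero    K g≤K = z≤n
sum-applyUpTo-≤ g (suc m) K g≤K =
  +-mono-≤ (g≤K 0 (s≤s z≤n)) (sum-applyUpTo-≤ (λ i → g (suc i)) m K (λ i i<m → g≤K (suc i) (s≤s i<m)))

module ConvBounds (φ : ℕ → ℕ) (c : ℕ) (1≤c : 1 ≤ c) (A : ℕ → ℕ)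
  (A-mono : ∀ {x y} → x ≤ y → A x ≤ A y)
  (rec : ∀ x → c * φ (2 + x) ≡ φ (1 + x) * A x + c * conv φ (2 + x))
  (gap : ∀ x → A (2 + x) * A (1 + x) + suc x * (c * (c * φ 2)) ≤ A (3 + x) * A (1 + x)) where

  open +-*-Solver

  cancel : ∀ {x y} → c * x ≤ c * y → x ≤ y
  cancel = *-cancelˡ-≤ c {{>-nonZero 1≤c}}

  Middle : ℕ → ℕ
  Middle k = sum (applyUpTo (λ i → φ (2 + i) * φ (suc k ∸ i)) k)

  conv-split : ∀ k → conv φ (3 + k) ≡ 2 * φ 1 * φ (2 + k) + Middle k
  conv-split k = begin
    g 0 + sum (applyUpTo (λ i → g (suc i)) (suc k))   ≡⟨ cong (g 0 +_) (sum-applyUpTo-last (λ i → g (suc i)) k) ⟩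
    g 0 + (Middle k + φ (2 + k) * φ (suc k ∸ k))     ≡⟨ cong (λ n → g 0 + (Middle k + φ (2 + k) * φ n)) (m+n∸n≡m 1 k) ⟩
    g 0 + (Middle k + φ (2 + k) * φ 1)               ≡⟨ solve 3 (λ a m b → a :* b :+ (m :+ b :* a) := con 2 :* a :* b :+ m)
                                                               refl (φ 1) (Middle k) (φ (2 + k)) ⟩
    2 * φ 1 * φ (2 + k) + Middle k                   ∎
    where
    open ≡-Reasoning
    g : ℕ → ℕ
    g i = φ (suc i) * φ (3 + k ∸ suc i)

  Exchange : ℕ → Set
  Exchange a = ∀ b → a ≤ b → φ a * φ b ≤ φ (a ∸ 1) * φ (suc b)

  ExchangeBelow : ℕ → Set
  ExchangeBelow n = ∀ a → 3 ≤ a → a < n → Exchange a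

  exchange-iterate : ∀ j m → 2 + j ≤ m → (∀ a → 3 ≤ a → a ≤ 2 + j → Exchange a) →
                     φ (2 + j) * φ m ≤ φ 2 * φ (j + m)
  exchange-iterate zero    m _   _  = ≤-refl
  exchange-iterate (suc j) m j≤m ex = begin
    φ (3 + j) * φ m          ≤⟨ ex (3 + j) (s≤s (s≤s (s≤s z≤n))) ≤-refl m j≤m ⟩
    φ (2 + j) * φ (suc m)    ≤⟨ exchange-iterate j (suc m) (≤-trans (n≤1+n (2 + j)) (m≤n⇒m≤1+n j≤m))
                                  (λ a 3≤a a≤ → ex a 3≤a (m≤n⇒m≤1+n a≤)) ⟩
    φ 2 * φ (j + suc m)      ≡⟨ cong (λ n → φ 2 * φ n) (+-suc j m) ⟩
    φ 2 * φ (suc j + m)      ∎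
    where open ≤-Reasoning

  private
    shift : ∀ j j′ → j + (2 + j′) ≡ 2 + j + j′
    shift j j′ = solve 2 (λ j j′ → j :+ (con 2 :+ j′) := con 2 :+ j :+ j′) refl j j′

  product-bound : ∀ n j j′ → ExchangeBelow n → 2 + j < n → 2 + j′ < n →
                  φ (2 + j) * φ (2 + j′) ≤ φ 2 * φ (2 + j + j′)
  product-bound n j j′ ex j<n j′<n with ≤-total j j′
  ... | inj₁ j≤j′ = subst (λ x → φ (2 + j) * φ (2 + j′) ≤ φ 2 * φ x) (shift j j′)
      (exchange-iterate j (2 + j′) (s≤s (s≤s j≤j′)) (λ a 3≤a a≤ → ex a 3≤a (≤-<-trans a≤ j<n)))
  ... | inj₂ j′≤j = subst₂ (λ x y → x ≤ φ 2 * φ y) (*-comm (φ (2 + j′)) (φ (2 + j))) (trans (shift j′ j) (cong (2 +_) (+-comm j′ j)))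
      (exchange-iterate j′ (2 + j) (s≤s (s≤s j′≤j)) (λ a 3≤a a≤ → ex a 3≤a (≤-<-trans a≤ j′<n)))

  middle-bound : ∀ k → ExchangeBelow (3 + k) → Middle k ≤ k * (φ 2 * φ (suc k))
  middle-bound k ex = sum-applyUpTo-≤ _ k _ term-bound
    where
    term-bound : ∀ i → i < k → φ (2 + i) * φ (suc k ∸ i) ≤ φ 2 * φ (suc k)
    term-bound i i<k = subst₂ (λ x y → φ (2 + i) * φ x ≤ φ 2 * φ y)
      (sym (+-∸-assoc 2 i<k)) (cong suc (m+[n∸m]≡n i<k))
      (product-bound (3 + k) i (k ∸ suc i) ex (s≤s (s≤s (s≤s (<⇒≤ i<k))))
                     (s≤s (s≤s (s≤s (m∸n≤m k (suc i))))))

  middle-absorbed : ∀ x → ExchangeBelow (3 + x) → ∀ y → suc x ≤ y →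
                    A (1 + x) * φ (2 + x) + c * Middle x ≤ A (1 + y) * φ (2 + x)
  middle-absorbed zero _ y _ = subst (_≤ A (1 + y) * φ 2) (sym (trans (cong (A 1 * φ 2 +_) (*-zeroʳ c)) (+-identityʳ _)))
                                     (*-monoˡ-≤ (φ 2) (A-mono (s≤s z≤n)))
  middle-absorbed (suc x) ex y x<y = cancel (begin
    c * (A₂ * X + c * Middle (suc x))
      ≡⟨ solve 4 (λ c a x m → c :* (a :* x :+ c :* m) := a :* (c :* x) :+ c :* (c :* m)) refl c A₂ X (Middle (suc x)) ⟩
    A₂ * (c * X) + c * (c * Middle (suc x))
      ≤⟨ +-monoʳ-≤ (A₂ * (c * X)) (*-monoʳ-≤ c (*-monoʳ-≤ c (middle-bound (suc x) ex))) ⟩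
    A₂ * (c * X) + c * (c * (suc x * (φ 2 * z)))
      ≡⟨ cong (λ t → A₂ * t + c * (c * (suc x * (φ 2 * z)))) (rec (suc x)) ⟩
    A₂ * (z * A₁ + w) + c * (c * (suc x * (φ 2 * z)))
      ≡⟨ solve 7 (λ a₂ z a₁ w k c f → a₂ :* (z :* a₁ :+ w) :+ c :* (c :* (k :* (f :* z)))
                                    := z :* (a₂ :* a₁ :+ k :* (c :* (c :* f))) :+ a₂ :* w)
               refl A₂ z A₁ w (suc x) c (φ 2) ⟩
    z * (A₂ * A₁ + suc x * (c * (c * φ 2))) + A₂ * w
      ≤⟨ +-mono-≤ (*-monoʳ-≤ z (gap x)) (*-monoˡ-≤ w (A-mono (n≤1+n (2 + x)))) ⟩
    z * (A₃ * A₁) + A₃ * w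
      ≡⟨ solve 4 (λ z a₃ a₁ w → z :* (a₃ :* a₁) :+ a₃ :* w := a₃ :* (z :* a₁ :+ w)) refl z A₃ A₁ w ⟩
    A₃ * (z * A₁ + w)
      ≡⟨ cong (A₃ *_) (sym (rec (suc x))) ⟩
    A₃ * (c * X)
      ≤⟨ *-monoˡ-≤ (c * X) (A-mono (s≤s x<y)) ⟩
    A (1 + y) * (c * X)
      ≡⟨ solve 3 (λ a c x → a :* (c :* x) := c :* (a :* x)) refl (A (1 + y)) c X ⟩
    c * (A (1 + y) * X) ∎)
    where
    open ≤-Reasoning
    X : ℕ
    X = φ (3 + x)
    z : ℕ
    z = φ (2 + x)
    w : ℕ
    w = c * conv φ (3 + x)
    A₁ : ℕ
    A₁ = A (1 + x)
    A₂ : ℕ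
    A₂ = A (2 + x)
    A₃ : ℕ
    A₃ = A (3 + x)

  exchange-step : ∀ x → ExchangeBelow (3 + x) → Exchange (3 + x)
  exchange-step x ex (suc (suc y)) (s≤s (s≤s x<y)) = cancel (begin
    c * (φ (3 + x) * φ₂₊ᵧ)
      ≡⟨ solve 3 (λ c a b → c :* (a :* b) := (c :* a) :* b) refl c (φ (3 + x)) φ₂₊ᵧ ⟩
    (c * φ (3 + x)) * φ₂₊ᵧ
      ≡⟨ cong (_* φ₂₊ᵧ) (trans (rec (suc x)) (cong (λ t → z * A (1 + x) + c * t) (conv-split x))) ⟩
    (z * A (1 + x) + c * (2 * φ 1 * z + Middle x)) * φ₂₊ᵧ
      ≡⟨ solve 6 (λ z a c f m b → (z :* a :+ c :* (con 2 :* f :* z :+ m)) :* b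
                                  := (a :* z :+ c :* m) :* b :+ c :* (con 2 :* f :* z) :* b)
               refl z (A (1 + x)) c (φ 1) (Middle x) φ₂₊ᵧ ⟩
    (A (1 + x) * z + c * Middle x) * φ₂₊ᵧ + c * (2 * φ 1 * z) * φ₂₊ᵧ
      ≤⟨ +-monoˡ-≤ (c * (2 * φ 1 * z) * φ₂₊ᵧ) (*-monoˡ-≤ φ₂₊ᵧ (middle-absorbed x ex y x<y)) ⟩
    A (1 + y) * z * φ₂₊ᵧ + c * (2 * φ 1 * z) * φ₂₊ᵧ
      ≡⟨ solve 5 (λ a z b c f → a :* z :* b :+ c :* (con 2 :* f :* z) :* b := z :* (b :* a :+ c :* (con 2 :* f :* b)))
               refl (A (1 + y)) z φ₂₊ᵧ c (φ 1) ⟩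
    z * (φ₂₊ᵧ * A (1 + y) + c * (2 * φ 1 * φ₂₊ᵧ))
      ≤⟨ *-monoʳ-≤ z (+-monoʳ-≤ (φ₂₊ᵧ * A (1 + y)) (*-monoʳ-≤ c (m≤m+n (2 * φ 1 * φ₂₊ᵧ) (Middle y)))) ⟩
    z * (φ₂₊ᵧ * A (1 + y) + c * (2 * φ 1 * φ₂₊ᵧ + Middle y))
      ≡⟨ cong (z *_) (sym (trans (rec (suc y)) (cong (λ t → φ₂₊ᵧ * A (1 + y) + c * t) (conv-split y)))) ⟩
    z * (c * φ (3 + y))
      ≡⟨ solve 3 (λ z c b → z :* (c :* b) := c :* (z :* b)) refl z c (φ (3 + y)) ⟩
    c * (z * φ (3 + y)) ∎)
    where
    open ≤-Reasoning
    z : ℕ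
    z = φ (2 + x)
    φ₂₊ᵧ : ℕ
    φ₂₊ᵧ = φ (2 + y)

  exchange : ∀ a → 3 ≤ a → Exchange a
  exchange = <-rec (λ a → 3 ≤ a → Exchange a) step
    where
    step : ∀ a → (∀ {b} → b < a → 3 ≤ b → Exchange b) → 3 ≤ a → Exchange a
    step 1 _ (s≤s ())
    step 2 _ (s≤s (s≤s ()))
    step (suc (suc (suc x))) below _ = exchange-step x (λ b 3≤b b<a → below b<a 3≤b)

  conv-bounds : ∀ n → 3 ≤ n →
    (2 * φ 1 * φ (n ∸ 1) ≤ conv φ n) × (conv φ n ≤ 2 * φ 1 * φ (n ∸ 1) + (n ∸ 3) * φ 2 * φ (n ∸ 2))
  conv-bounds 1 (s≤s ())
  conv-bounds 2 (s≤s (s≤s ()))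
  conv-bounds (suc (suc (suc k))) _ rewrite conv-split k =
      m≤m+n (2 * φ 1 * φ (2 + k)) (Middle k)
    , +-monoʳ-≤ (2 * φ 1 * φ (2 + k))
        (subst (Middle k ≤_) (sym (*-assoc k (φ 2) (φ (suc k)))) (middle-bound k (λ a 3≤a _ → exchange a 3≤a)))

lemma4 : (p : ℕ) → 1 ≤ p → (φ : ℕ → ℕ) →
    (∀ n → 1 ≤ n → Fin (φ n) ↔ BCITerm p (n * (2 * p + 1) ∸ 1)) →
    ∀ n → 3 ≤ n →
      (2 * φ 1 * φ (n ∸ 1) ≤ conv φ n) ×
      (conv φ n ≤ 2 * φ 1 * φ (n ∸ 1) + (n ∸ 3) * φ 2 * φ (n ∸ 2))
lemma4 zero    () φ φ↔
lemma4 (suc q) _  φ φ↔ = conv-bounds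
  where
  open Binding (suc q) using (A)
  open Recurrence q φ φ↔
  open Growth q using (A-mono; A-gap)
  gap : ∀ x → A (2 + x) * A (1 + x) + suc x * (orders * (orders * φ 2)) ≤ A (3 + x) * A (1 + x)
  gap x = subst (λ t → A (2 + x) * A (1 + x) + suc x * t ≤ A (3 + x) * A (1 + x)) (sym orders²φ₂) (A-gap x)
  open ConvBounds φ orders (rising-pos 0 (suc q)) A A-mono recurrence gap
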